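{- Let $q$ be a prime power, $\mathscr Q_n$ a non-singular quadric in $\mathrm{PG}(n,q)$ of projective index $g$ with point-graph $\Gamma$, $s$ an integer with $0\le s<g$, $\alpha_s$ an $s$-dimensional subspace contained in $\mathscr Q_n$, and $\{\mathcal X_s,\mathcal Y_s\}$ the associated partition of the vertices of $\Gamma$. Then every vertex of $\mathcal Y_s$ is adjacent in $\Gamma$ to either $0$, $\frac12|\mathcal X_s|$ or $|\mathcal X_s|$ vertices of $\mathcal X_s$ if and only if $q=2$.
   Context: The projective index $g$ of a non-singular quadric is the largest dimension of a subspace contained in it. The point-graph $\Gamma$ of $\mathscr Q_n$ has the points of $\mathscr Q_n$ as vertices, two distinct points adjacent iff the line joining them is contained in $\mathscr Q_n$. Points of $\mathscr Q_n$ are of type (i) if in $\alpha_s$; of type (ii) if not in $\alpha_s$ but in some $(s+1)$-dimensional subspace $\Pi$ with $\alpha_s\subset\Pi\subseteq\mathscr Q_n$; of type (iii) otherwise. $\mathcal X_s$ is the set of type (ii) points and $\mathcal Y_s$ the set of type (i) and (iii) points. -}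

module Defs where

open import Data.Nat using (ℕ; zero; suc; _≤_)
open import Data.Fin using (Fin)
open import Data.Vec using (Vec; []; _∷_; zipWith; map; foldr)
open import Data.Vec.Relation.Unary.All using (All)
open import Data.List using (List; length)
open import Data.List.Membership.Propositional using (_∈_)
open import Data.List.Relation.Unary.Unique.Propositional using (Unique)
open import Data.Product using (Σ; ∃; _×_)
open import Data.Sum using (_⊎_)
open import Data.Empty using (⊥)
open import Relation.Nullary using (¬_)
open import Relation.Binary.PropositionalEquality using (_≡_)
open import Algebra.Structures using (IsCommutativeRing)
open import Function.Bundles using (_↔_)

-- A finite field with `size` elements (size is then automatically a prime power).
record FiniteField : Set₁ where
  field
    F : Set
    _+_ _*_ : F → F → F
    -_ : F → F
    0# 1# : F
    isCommutativeRing : IsCommutativeRing _≡_ _+_ _*_ -_ 0# 1#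
    0≢1 : ¬ (0# ≡ 1#)
    inverse : ∀ x → ¬ (x ≡ 0#) → ∃ λ y → x * y ≡ 1#
    size : ℕ
    enumeration : Fin size ↔ F

HasSize : {A : Set} → (A → Set) → ℕ → Set
HasSize {A} P k = Σ (List A) λ xs →
  Unique xs × (∀ a → a ∈ xs → P a) × (∀ a → P a → a ∈ xs) × length xs ≡ k

module Geometry (K : FiniteField) where
  open FiniteField K

  -- vectors of F^(n+1), the underlying space of PG(n,q)
  V : ℕ → Set
  V n = Vec F (suc n)

  sumV : {m : ℕ} → Vec F m → F
  sumV = foldr _ _+_ 0#

  zeroV : {m : ℕ} → Vec F m
  zeroV {zero} = []
  zeroV {suc m} = 0# ∷ zeroV

  _+V_ : {m : ℕ} → Vec F m → Vec F m → Vec F m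
  _+V_ = zipWith _+_

  _·_ : {m : ℕ} → F → Vec F m → Vec F m
  c · v = map (c *_) v

  _-_ : F → F → F
  x - y = x + (- y)

  lincomb : {n k : ℕ} → Vec F k → Vec (V n) k → V n
  lincomb [] [] = zeroV
  lincomb (c ∷ cs) (v ∷ vs) = (c · v) +V lincomb cs vs

  QMat : ℕ → Set
  QMat n = Vec (V n) (suc n)

  Q : {n : ℕ} → QMat n → V n → F
  Q a x = sumV (zipWith (λ row xi → xi * sumV (zipWith _*_ row x)) a x)

  B : {n : ℕ} → QMat n → V n → V n → F
  B a x y = (Q a (x +V y) - Q a x) - Q a y

  NonSingular : {n : ℕ} → QMat n → Set
  NonSingular a = ∀ x → ¬ (x ≡ zeroV) → Q a x ≡ 0# → ¬ (∀ y → B a x y ≡ 0#)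

  -- points of PG(n,q): canonical representatives (first non-zero coordinate is 1)
  Normalized : {m : ℕ} → Vec F m → Set
  Normalized [] = ⊥
  Normalized (x ∷ xs) = (x ≡ 1#) ⊎ ((x ≡ 0#) × Normalized xs)

  QPoint : {n : ℕ} → QMat n → V n → Set
  QPoint a x = Normalized x × Q a x ≡ 0#

  Adjacent : {n : ℕ} → QMat n → V n → V n → Set
  Adjacent a x y = QPoint a x × QPoint a y × ¬ (x ≡ y) ×
    (∀ λ' μ → Q a ((λ' · x) +V (μ · y)) ≡ 0#)

  Independent : {n k : ℕ} → Vec (V n) k → Set
  Independent vs = ∀ c → lincomb c vs ≡ zeroV → All (_≡ 0#) c

  InSpan : {n k : ℕ} → Vec (V n) k → V n → Set
  InSpan vs x = ∃ λ c → lincomb c vs ≡ x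

  ContainedIn : {n k : ℕ} → QMat n → Vec (V n) k → Set
  ContainedIn a vs = ∀ c → Q a (lincomb c vs) ≡ 0#

  -- projective dimension d subspaces are spanned by d+1 independent vectors
  -- g is the projective index: the largest dimension of a subspace contained in Q_n
  ProjIndex : {n : ℕ} → QMat n → ℕ → Set
  ProjIndex {n} a g =
    (Σ (Vec (V n) (suc g)) λ vs → Independent vs × ContainedIn a vs) ×
    (∀ d (vs : Vec (V n) (suc d)) → Independent vs → ContainedIn a vs → d ≤ g)

  TypeI : {n s : ℕ} → QMat n → Vec (V n) (suc s) → V n → Set
  TypeI a α x = QPoint a x × InSpan α x

  TypeII : {n s : ℕ} → QMat n → Vec (V n) (suc s) → V n → Set
  TypeII {n} {s} a α x = QPoint a x × ¬ InSpan α x ×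
    (Σ (Vec (V n) (suc (suc s))) λ Π →
       Independent Π × ContainedIn a Π × (∀ v → InSpan α v → InSpan Π v) × InSpan Π x)

  TypeIII : {n s : ℕ} → QMat n → Vec (V n) (suc s) → V n → Set
  TypeIII a α x = QPoint a x × ¬ TypeI a α x × ¬ TypeII a α x

  𝒳 : {n s : ℕ} → QMat n → Vec (V n) (suc s) → V n → Set
  𝒳 = TypeII

  𝒴 : {n s : ℕ} → QMat n → Vec (V n) (suc s) → V n → Set
  𝒴 a α x = TypeI a α x ⊎ TypeIII a α x

module Submission where

-- Write polar for the bilinear form of Q. A point of the quadric is of type (ii) iff it lies outside α and
-- is orthogonal to α. A point y of type (i) lies in α, hence is adjacent to all of 𝒳. A point y of type (iii)
-- is not orthogonal to α, so polar y p ≡ 1 for some p in α; then (t , x) ↦ ⟨x + t p⟩ maps F × (𝒳 ∩ y⊥)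
-- bijectively onto 𝒳, so |𝒳| = q · |𝒳 ∩ y⊥|. This gives the three values when q = 2. When q > 2 one needs a
-- point of type (iii) with a neighbour in 𝒳: non-singularity provides the former, and a totally singular
-- subspace of dimension g > s contains a vector orthogonal to α outside α, giving a point of 𝒳.

open import Defs
open import Data.Nat using (ℕ; suc; _<_)
open import Data.Vec using (Vec)
open import Data.Sum using (_⊎_)
open import Data.Product using (_×_)
open import Relation.Binary.PropositionalEquality using (_≡_)
open import Function.Bundles using (_⇔_)

open import Level using (0ℓ)
open import Algebra.Bundles using (CommutativeRing)
open import Tactic.RingSolver.Core.AlmostCommutativeRing using (fromCommutativeRing)
open import Data.Empty using (⊥-elim)
open import Data.Unit using (⊤; tt)
open import Data.Maybe using (nothing)
open import Data.Nat as ℕ using (zero; z≤n; s≤s; _≤_; _^_)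
import Data.Nat.Properties as ℕₚ
open import Data.Fin as Fin using (Fin)
open import Data.Product using (∃; ∃₂; _,_; proj₁; proj₂)
open import Data.Product.Properties using (×-≡,≡→≡)
open import Data.Sum using (inj₁; inj₂)
open import Data.List as List using (List; []; _∷_; length; map; filter; cartesianProduct)
open import Data.List.Properties using (length-map; length-++; length-tabulate)
open import Data.List.Membership.Propositional using (_∈_; lose)
open import Data.List.Membership.Propositional.Properties
  using (∈-map⁺; ∈-map⁻; ∈-filter⁺; ∈-filter⁻; ∈-allFin; ∈-cartesianProduct⁺; ∈-cartesianProduct⁻)
open import Data.List.Relation.Unary.Any using (here; there; satisfied; any?)
import Data.List.Relation.Unary.All as ListAll
import Data.List.Relation.Unary.All.Properties as ListAll
open import Data.List.Relation.Unary.AllPairs using ([]; _∷_)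
open import Data.List.Relation.Unary.Unique.Propositional using (Unique)
import Data.List.Relation.Unary.Unique.Propositional.Properties as Unique
open import Data.List.Relation.Binary.Subset.Propositional using (_⊆_)
open import Data.Vec as Vec using ([]; _∷_; zipWith)
import Data.Vec.Properties as Vecₚ
import Data.Vec.Relation.Unary.All as VecAll
import Data.Vec.Relation.Unary.All.Properties as VecAllₚ
open import Function.Bundles using (Inverse; Equivalence; mk⇔)
open import Function.Properties.Inverse using (↔⇒↣; ↔-sym)
open import Relation.Nullary using (¬_; Dec; yes; no)
open import Relation.Nullary.Decidable using (map′; via-injection; ¬?; decidable-stable; _×-dec_; _⊎-dec_)
open import Relation.Unary using (Decidable)
open import Relation.Binary.Definitions using (DecidableEquality)
open import Relation.Binary.PropositionalEquality
  using (refl; sym; trans; cong; cong₂; subst; _≢_; module ≡-Reasoning)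

module _ {A : Set} where

  private
    remove : ∀ {x : A} (ys : List A) → x ∈ ys → List A
    remove (y ∷ ys) (here _)  = ys
    remove (y ∷ ys) (there p) = y ∷ remove ys p

    length-remove : ∀ {x : A} ys (p : x ∈ ys) → suc (length (remove ys p)) ≡ length ys
    length-remove (y ∷ ys) (here _)  = refl
    length-remove (y ∷ ys) (there p) = cong suc (length-remove ys p)

    ∈-remove⁺ : ∀ {x z : A} ys (p : x ∈ ys) → z ∈ ys → z ≢ x → z ∈ remove ys p
    ∈-remove⁺ (y ∷ ys) (here refl) (here refl) z≢x = ⊥-elim (z≢x refl)
    ∈-remove⁺ (y ∷ ys) (here refl) (there q)   z≢x = q
    ∈-remove⁺ (y ∷ ys) (there p)   (here refl) z≢x = here refl
    ∈-remove⁺ (y ∷ ys) (there p)   (there q)   z≢x = there (∈-remove⁺ ys p q z≢x)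

  Unique⇒length≤ : {xs ys : List A} → Unique xs → xs ⊆ ys → length xs ≤ length ys
  Unique⇒length≤ {[]}     _             _     = z≤n
  Unique⇒length≤ {x ∷ xs} {ys} (x∉xs ∷ xs!) xs⊆ys =
    subst (suc (length xs) ≤_) (length-remove ys x∈ys)
      (s≤s (Unique⇒length≤ xs! λ z∈xs →
        ∈-remove⁺ ys x∈ys (xs⊆ys (there z∈xs)) (λ z≡x → ListAll.lookup x∉xs z∈xs (sym z≡x))))
    where x∈ys = xs⊆ys (here refl)

  Unique-map⁺ : {B : Set} (f : A → B) {xs : List A} → Unique xs →
                (∀ {x y} → x ∈ xs → y ∈ xs → f x ≡ f y → x ≡ y) → Unique (map f xs)
  Unique-map⁺ f {[]}     []           inj = []
  Unique-map⁺ f {x ∷ xs} (x∉xs ∷ xs!) inj =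
    ListAll.map⁺ (ListAll.tabulate λ y∈xs fx≡fy →
      ListAll.lookup x∉xs y∈xs (inj (here refl) (there y∈xs) fx≡fy))
    ∷ Unique-map⁺ f xs! (λ x∈ y∈ → inj (there x∈) (there y∈))

length-cartesianProduct : {A B : Set} (xs : List A) (ys : List B) →
                          length (cartesianProduct xs ys) ≡ length xs ℕ.* length ys
length-cartesianProduct []       ys = refl
length-cartesianProduct (x ∷ xs) ys = begin
  length (map (x ,_) ys List.++ cartesianProduct xs ys) ≡⟨ length-++ (map (x ,_) ys) ⟩
  length (map (x ,_) ys) ℕ.+ length (cartesianProduct xs ys)
    ≡⟨ cong₂ ℕ._+_ (length-map (x ,_) ys) (length-cartesianProduct xs ys) ⟩
  length ys ℕ.+ length xs ℕ.* length ys ∎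
  where open ≡-Reasoning

All⊎∃¬ : ∀ {A : Set} {k} {P : A → Set} → Decidable P → (W : Vec A k) →
         VecAll.All P W ⊎ ∃ λ j → ¬ P (Vec.lookup W j)
All⊎∃¬ P? []       = inj₁ VecAll.[]
All⊎∃¬ P? (w ∷ ws) with P? w | All⊎∃¬ P? ws
... | no ¬pw | _                = inj₂ (Fin.zero , ¬pw)
... | yes pw | inj₁ pws         = inj₁ (pw VecAll.∷ pws)
... | yes pw | inj₂ (j , ¬pwⱼ) = inj₂ (Fin.suc j , ¬pwⱼ)

All-removeAt : ∀ {A : Set} {P : A → Set} {k} (v : Vec A (suc k)) j →
               VecAll.All P v → VecAll.All P (Vec.removeAt v j)
All-removeAt (x ∷ xs)     Fin.zero    (_ VecAll.∷ ps)  = ps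
All-removeAt (x ∷ y ∷ xs) (Fin.suc j) (p VecAll.∷ ps) = p VecAll.∷ All-removeAt (y ∷ xs) j ps

HasCardinality : Set → ℕ → Set
HasCardinality A = HasSize {A} (λ _ → ⊤)

module _ {A : Set} {P : A → Set} where

  HasSize-unique : ∀ {k l} → HasSize P k → HasSize P l → k ≡ l
  HasSize-unique (xs , xs! , xs⊆P , P⊆xs , refl) (ys , ys! , ys⊆P , P⊆ys , refl) =
    ℕₚ.≤-antisym (Unique⇒length≤ xs! λ x∈ → P⊆ys _ (xs⊆P _ x∈))
              (Unique⇒length≤ ys! λ y∈ → P⊆xs _ (ys⊆P _ y∈))

  HasSize⇒≢0 : ∀ {k x} → HasSize P k → P x → k ≢ 0
  HasSize⇒≢0 (xs , _ , _ , P⊆xs , refl) px = ∈⇒length≢0 (P⊆xs _ px)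
    where
    ∈⇒length≢0 : ∀ {x : A} {ys} → x ∈ ys → length ys ≢ 0
    ∈⇒length≢0 (here _)  ()
    ∈⇒length≢0 (there _) ()

  HasSize-image : {B : Set} {S : B → Set} {k : ℕ} (f : A → B) →
                  (∀ {x y} → P x → P y → f x ≡ f y → x ≡ y) →
                  (∀ {x} → P x → S (f x)) → (∀ {z} → S z → ∃ λ x → P x × f x ≡ z) →
                  HasSize P k → HasSize S k
  HasSize-image {S = S} f inj P⇒S S⇒P (xs , xs! , xs⊆P , P⊆xs , refl) =
    map f xs ,
    Unique-map⁺ f xs! (λ x∈ y∈ → inj (xs⊆P _ x∈) (xs⊆P _ y∈)) ,
    (λ z z∈ → case-∈map (∈-map⁻ f z∈)) ,
    (λ z sz → let (x , px , fx≡z) = S⇒P sz in subst (_∈ map f xs) fx≡z (∈-map⁺ f (P⊆xs x px))) ,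
    length-map f xs
    where
    case-∈map : ∀ {z} → (∃ λ x → x ∈ xs × z ≡ f x) → S z
    case-∈map (x , x∈ , refl) = P⇒S (xs⊆P x x∈)

  HasSize-onto⇒≤ : {B : Set} {S : B → Set} {k l : ℕ} (f : A → B) →
                   (∀ {z} → S z → ∃ λ x → P x × f x ≡ z) →
                   HasSize P k → HasSize S l → l ≤ k
  HasSize-onto⇒≤ f S⇒P (xs , _ , _ , P⊆xs , refl) (zs , zs! , zs⊆S , _ , refl) =
    subst (_ ≤_) (length-map f xs) (Unique⇒length≤ zs! λ {z} z∈ →
      let (x , px , fx≡z) = S⇒P (zs⊆S z z∈) in subst (_∈ map f xs) fx≡z (∈-map⁺ f (P⊆xs x px)))

  HasSize-filter : ∀ {k} → HasCardinality A k → Decidable P → ∃ (HasSize P)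
  HasSize-filter (xs , xs! , _ , all , _) P? =
    length (filter P? xs) , filter P? xs , Unique.filter⁺ P? {xs} xs! ,
    (λ x x∈ → proj₂ (∈-filter⁻ P? {xs = xs} x∈)) , (λ x px → ∈-filter⁺ P? (all x tt) px) , refl

  finite-∃? : ∀ {k} → HasCardinality A k → Decidable P → Dec (∃ P)
  finite-∃? (xs , _ , _ , all , _) P? =
    map′ satisfied (λ (x , px) → lose (all x tt) px) (any? P? xs)

HasSize-× : {A B : Set} {P : A → Set} {R : B → Set} {k l : ℕ} →
            HasSize P k → HasSize R l → HasSize (λ ab → P (proj₁ ab) × R (proj₂ ab)) (k ℕ.* l)
HasSize-× (xs , xs! , xs⊆P , P⊆xs , refl) (ys , ys! , ys⊆R , R⊆ys , refl) =
  cartesianProduct xs ys , Unique.cartesianProduct⁺ xs! ys! ,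
  (λ (x , y) xy∈ → let (x∈ , y∈) = ∈-cartesianProduct⁻ xs ys xy∈ in xs⊆P x x∈ , ys⊆R y y∈) ,
  (λ (x , y) (px , ry) → ∈-cartesianProduct⁺ (P⊆xs x px) (R⊆ys y ry)) ,
  length-cartesianProduct xs ys

count-alternatives⇒q≡2 : ∀ q c → 2 ≤ q → c ≢ 0 → (c ≡ 0 ⊎ 2 ℕ.* c ≡ q ℕ.* c ⊎ c ≡ q ℕ.* c) → q ≡ 2
count-alternatives⇒q≡2 q zero    _   c≢0 _                = ⊥-elim (c≢0 refl)
count-alternatives⇒q≡2 q (suc c) _   _   (inj₁ ())
count-alternatives⇒q≡2 q (suc c) _   _   (inj₂ (inj₁ eq)) = sym (ℕₚ.*-cancelʳ-≡ 2 q (suc c) eq)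
count-alternatives⇒q≡2 q (suc c) 2≤q _   (inj₂ (inj₂ eq)) =
  ⊥-elim (ℕₚ.<-irrefl refl (subst (2 ≤_) (sym 1≡q) 2≤q))
  where
  1≡q : 1 ≡ q
  1≡q = ℕₚ.*-cancelʳ-≡ 1 q (suc c) (trans (ℕₚ.*-identityˡ (suc c)) eq)

module FieldProperties (K : FiniteField) where
  open FiniteField K public using (F; size; 0≢1)
  open FiniteField K using (isCommutativeRing; inverse; enumeration)

  commutativeRing : CommutativeRing 0ℓ 0ℓ
  commutativeRing = record { isCommutativeRing = isCommutativeRing }

  open CommutativeRing commutativeRing public
    using ( _+_; _*_; -_; 0#; 1#; +-comm; +-assoc; *-comm; *-assoc; distribˡ; distribʳ
          ; +-identityˡ; +-identityʳ; *-identityˡ; *-identityʳ; zeroˡ; zeroʳ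
          ; -‿inverseˡ; -‿inverseʳ; ring; +-commutativeSemigroup; *-commutativeSemigroup)
  open import Algebra.Properties.Ring ring public
    using (-‿distribˡ-*; -1*x≈-x; +-cancelˡ; x∙y⁻¹≈ε⇒x≈y)
  open import Algebra.Properties.CommutativeSemigroup +-commutativeSemigroup public
    using () renaming (interchange to +-interchange)
  open import Algebra.Properties.CommutativeSemigroup *-commutativeSemigroup public
    using () renaming (x∙yz≈y∙xz to x*yz≡y*xz)

  open import Tactic.RingSolver.NonReflective
    (fromCommutativeRing commutativeRing (λ _ → nothing)) public
    using (solve; _⊜_; _⊕_)

  open ≡-Reasoning

  1≢0 : 1# ≢ 0#
  1≢0 1≡0 = 0≢1 (sym 1≡0)

  inv : (x : F) → x ≢ 0# → F
  inv x x≢0 = proj₁ (inverse x x≢0)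

  inv-inverseʳ : ∀ x (x≢0 : x ≢ 0#) → x * inv x x≢0 ≡ 1#
  inv-inverseʳ x x≢0 = proj₂ (inverse x x≢0)

  inv-inverseˡ : ∀ x (x≢0 : x ≢ 0#) → inv x x≢0 * x ≡ 1#
  inv-inverseˡ x x≢0 = trans (*-comm _ x) (inv-inverseʳ x x≢0)

  inv≢0 : ∀ x (x≢0 : x ≢ 0#) → inv x x≢0 ≢ 0#
  inv≢0 x x≢0 i≡0 = 1≢0 (trans (sym (inv-inverseʳ x x≢0)) (trans (cong (x *_) i≡0) (zeroʳ x)))

  *-cancelˡ : ∀ x y z → x ≢ 0# → x * y ≡ x * z → y ≡ z
  *-cancelˡ x y z x≢0 xy≡xz = begin
    y                       ≡⟨ sym (*-identityˡ y) ⟩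
    1# * y                  ≡⟨ cong (_* y) (sym (inv-inverseˡ x x≢0)) ⟩
    (inv x x≢0 * x) * y     ≡⟨ *-assoc _ x y ⟩
    inv x x≢0 * (x * y)     ≡⟨ cong (inv x x≢0 *_) xy≡xz ⟩
    inv x x≢0 * (x * z)     ≡⟨ sym (*-assoc _ x z) ⟩
    (inv x x≢0 * x) * z     ≡⟨ cong (_* z) (inv-inverseˡ x x≢0) ⟩
    1# * z                  ≡⟨ *-identityˡ z ⟩
    z                       ∎

  x*y≡0⇒y≡0 : ∀ x y → x ≢ 0# → x * y ≡ 0# → y ≡ 0#
  x*y≡0⇒y≡0 x y x≢0 xy≡0 = *-cancelˡ x y 0# x≢0 (trans xy≡0 (sym (zeroʳ x)))

  *-≢0 : ∀ x y → x ≢ 0# → y ≢ 0# → x * y ≢ 0#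
  *-≢0 x y x≢0 y≢0 xy≡0 = y≢0 (x*y≡0⇒y≡0 x y x≢0 xy≡0)

  +-*-inv-cancel : ∀ β (β≢0 : β ≢ 0#) u → u + (- (u * inv β β≢0)) * β ≡ 0#
  +-*-inv-cancel β β≢0 u = begin
    u + (- (u * i)) * β ≡⟨ cong (u +_) (sym (-‿distribˡ-* (u * i) β)) ⟩
    u + - ((u * i) * β) ≡⟨ cong (λ z → u + - z) (trans (*-assoc u i β)
                                                   (trans (cong (u *_) (inv-inverseˡ β β≢0)) (*-identityʳ u))) ⟩
    u + - u             ≡⟨ -‿inverseʳ u ⟩
    0#                  ∎
    where i = inv β β≢0

  _≟_ : DecidableEquality F
  _≟_ = via-injection (↔⇒↣ (↔-sym enumeration)) Fin._≟_

  F-cardinality : HasCardinality F size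
  F-cardinality =
    map to (List.allFin size) ,
    Unique.map⁺ to-injective (Unique.allFin⁺ size) ,
    (λ _ _ → tt) ,
    (λ x _ → subst (_∈ _) (inverseˡ refl) (∈-map⁺ to (∈-allFin (from x)))) ,
    trans (length-map to (List.allFin size)) (length-tabulate (λ i → i))
    where
    open Inverse enumeration using (to; from; inverseˡ; inverseʳ)
    to-injective : ∀ {i j} → to i ≡ to j → i ≡ j
    to-injective {i} {j} eq = trans (sym (inverseʳ refl)) (trans (cong from eq) (inverseʳ refl))

  2≤size : 2 ≤ size
  2≤size with F-cardinality
  ... | xs , _ , _ , all , refl =
    Unique⇒length≤ ((0≢1 ListAll.∷ ListAll.[]) ∷ ListAll.[] ∷ []) λ {x} _ → all x tt

module VectorSpace (K : FiniteField) where
  open FieldProperties K public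
  open Geometry K public

  open ≡-Reasoning

  +V-comm : ∀ {m} (u v : Vec F m) → u +V v ≡ v +V u
  +V-comm = Vecₚ.zipWith-comm +-comm

  +V-assoc : ∀ {m} (u v w : Vec F m) → (u +V v) +V w ≡ u +V (v +V w)
  +V-assoc = Vecₚ.zipWith-assoc +-assoc

  +V-identityˡ : ∀ {m} (v : Vec F m) → zeroV +V v ≡ v
  +V-identityˡ []      = refl
  +V-identityˡ (x ∷ v) = cong₂ _∷_ (+-identityˡ x) (+V-identityˡ v)

  +V-identityʳ : ∀ {m} (v : Vec F m) → v +V zeroV ≡ v
  +V-identityʳ v = trans (+V-comm v zeroV) (+V-identityˡ v)

  +V-interchange : ∀ {m} (u v w z : Vec F m) → (u +V v) +V (w +V z) ≡ (u +V w) +V (v +V z)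
  +V-interchange u v w z = begin
    (u +V v) +V (w +V z) ≡⟨ +V-assoc u v (w +V z) ⟩
    u +V (v +V (w +V z)) ≡⟨ cong (u +V_) (sym (+V-assoc v w z)) ⟩
    u +V ((v +V w) +V z) ≡⟨ cong (λ t → u +V (t +V z)) (+V-comm v w) ⟩
    u +V ((w +V v) +V z) ≡⟨ cong (u +V_) (+V-assoc w v z) ⟩
    u +V (w +V (v +V z)) ≡⟨ sym (+V-assoc u w (v +V z)) ⟩
    (u +V w) +V (v +V z) ∎

  +V-inverseʳ : ∀ {m} (v : Vec F m) → v +V ((- 1#) · v) ≡ zeroV
  +V-inverseʳ []      = refl
  +V-inverseʳ (x ∷ v) = cong₂ _∷_ (trans (cong (x +_) (-1*x≈-x x)) (-‿inverseʳ x)) (+V-inverseʳ v)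

  +V-cancelˡ : ∀ {m} (w u v : Vec F m) → w +V u ≡ w +V v → u ≡ v
  +V-cancelˡ []       []      []      _  = refl
  +V-cancelˡ (w ∷ ws) (x ∷ u) (y ∷ v) eq =
    cong₂ _∷_ (+-cancelˡ w x y (Vecₚ.∷-injectiveˡ eq)) (+V-cancelˡ ws u v (Vecₚ.∷-injectiveʳ eq))

  +V-cancelʳ : ∀ {m} (w u v : Vec F m) → u +V w ≡ v +V w → u ≡ v
  +V-cancelʳ w u v eq = +V-cancelˡ w u v (trans (+V-comm w u) (trans eq (+V-comm v w)))

  x+u-u≡x : ∀ {m} (x u : Vec F m) → (x +V u) +V ((- 1#) · u) ≡ x
  x+u-u≡x x u = trans (+V-assoc x u _) (trans (cong (x +V_) (+V-inverseʳ u)) (+V-identityʳ x))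

  ·-distribˡ : ∀ {m} c (u v : Vec F m) → c · (u +V v) ≡ (c · u) +V (c · v)
  ·-distribˡ c []      []      = refl
  ·-distribˡ c (x ∷ u) (y ∷ v) = cong₂ _∷_ (distribˡ c x y) (·-distribˡ c u v)

  ·-distribʳ : ∀ {m} c d (v : Vec F m) → (c + d) · v ≡ (c · v) +V (d · v)
  ·-distribʳ c d []      = refl
  ·-distribʳ c d (x ∷ v) = cong₂ _∷_ (distribʳ x c d) (·-distribʳ c d v)

  ·-assoc : ∀ {m} c d (v : Vec F m) → c · (d · v) ≡ (c * d) · v
  ·-assoc c d []      = refl
  ·-assoc c d (x ∷ v) = cong₂ _∷_ (sym (*-assoc c d x)) (·-assoc c d v)

  ·-identityˡ : ∀ {m} (v : Vec F m) → 1# · v ≡ v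
  ·-identityˡ []      = refl
  ·-identityˡ (x ∷ v) = cong₂ _∷_ (*-identityˡ x) (·-identityˡ v)

  ·-zeroˡ : ∀ {m} (v : Vec F m) → 0# · v ≡ zeroV
  ·-zeroˡ []      = refl
  ·-zeroˡ (x ∷ v) = cong₂ _∷_ (zeroˡ x) (·-zeroˡ v)

  ·-zeroʳ : ∀ {m} c → c · zeroV {m} ≡ zeroV
  ·-zeroʳ {zero}  c = refl
  ·-zeroʳ {suc m} c = cong₂ _∷_ (zeroʳ c) (·-zeroʳ c)

  ·-inv : ∀ {m} l (l≢0 : l ≢ 0#) (v : Vec F m) → inv l l≢0 · (l · v) ≡ v
  ·-inv l l≢0 v = trans (·-assoc _ l v) (trans (cong (_· v) (inv-inverseˡ l l≢0)) (·-identityˡ v))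

  ·-≢zeroV : ∀ {m} l (v : Vec F m) → l ≢ 0# → v ≢ zeroV → l · v ≢ zeroV
  ·-≢zeroV l v l≢0 v≢0 lv≡0 =
    v≢0 (trans (sym (·-inv l l≢0 v)) (trans (cong (inv l l≢0 ·_) lv≡0) (·-zeroʳ _)))

  _≟V_ : ∀ {m} → DecidableEquality (Vec F m)
  _≟V_ = Vecₚ.≡-dec _≟_

  Vec-cardinality : ∀ m → HasCardinality (Vec F m) (size ^ m)
  Vec-cardinality zero    = [] ∷ [] , ListAll.[] ∷ [] , (λ _ _ → tt) , (λ { [] _ → here refl }) , refl
  Vec-cardinality (suc m) =
    HasSize-image (λ (x , v) → x ∷ v) (λ _ _ eq → ×-≡,≡→≡ (Vecₚ.∷-injective eq)) (λ _ → tt)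
      (λ { {x ∷ v} _ → (x , v) , (tt , tt) , refl })
      (HasSize-× F-cardinality (Vec-cardinality m))

  lincomb-+ : ∀ {n k} (c d : Vec F k) (vs : Vec (V n) k) →
              lincomb (c +V d) vs ≡ lincomb c vs +V lincomb d vs
  lincomb-+ []       []       []       = sym (+V-identityˡ zeroV)
  lincomb-+ (c ∷ cs) (d ∷ ds) (v ∷ vs) = begin
    ((c + d) · v) +V lincomb (cs +V ds) vs
      ≡⟨ cong₂ _+V_ (·-distribʳ c d v) (lincomb-+ cs ds vs) ⟩
    ((c · v) +V (d · v)) +V (lincomb cs vs +V lincomb ds vs)
      ≡⟨ +V-interchange (c · v) (d · v) _ _ ⟩
    ((c · v) +V lincomb cs vs) +V ((d · v) +V lincomb ds vs) ∎

  lincomb-· : ∀ {n k} e (c : Vec F k) (vs : Vec (V n) k) → lincomb (e · c) vs ≡ e · lincomb c vs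
  lincomb-· e []       []       = sym (·-zeroʳ e)
  lincomb-· e (c ∷ cs) (v ∷ vs) = begin
    ((e * c) · v) +V lincomb (e · cs) vs ≡⟨ cong₂ _+V_ (sym (·-assoc e c v)) (lincomb-· e cs vs) ⟩
    (e · (c · v)) +V (e · lincomb cs vs) ≡⟨ sym (·-distribˡ e (c · v) _) ⟩
    e · ((c · v) +V lincomb cs vs)       ∎

  lincomb-zero : ∀ {n k} (vs : Vec (V n) k) → lincomb zeroV vs ≡ zeroV
  lincomb-zero []       = refl
  lincomb-zero (v ∷ vs) = trans (cong₂ _+V_ (·-zeroˡ v) (lincomb-zero vs)) (+V-identityˡ zeroV)

  lincomb-injective : ∀ {n k} {vs : Vec (V n) k} → Independent vs →
                      ∀ c d → lincomb c vs ≡ lincomb d vs → c ≡ d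
  lincomb-injective {vs = vs} ind c d eq = difference≡0⇒≡ c d (ind _ (begin
    lincomb (c +V ((- 1#) · d)) vs            ≡⟨ lincomb-+ c _ vs ⟩
    lincomb c vs +V lincomb ((- 1#) · d) vs  ≡⟨ cong₂ _+V_ eq (lincomb-· (- 1#) d vs) ⟩
    lincomb d vs +V ((- 1#) · lincomb d vs)  ≡⟨ +V-inverseʳ _ ⟩
    zeroV                                     ∎))
    where
    difference≡0⇒≡ : ∀ {m} (c d : Vec F m) → VecAll.All (_≡ 0#) (c +V ((- 1#) · d)) → c ≡ d
    difference≡0⇒≡ []       []       _              = refl
    difference≡0⇒≡ (c ∷ cs) (d ∷ ds) (e VecAll.∷ es) =
      cong₂ _∷_ (x∙y⁻¹≈ε⇒x≈y c d (trans (cong (c +_) (sym (-1*x≈-x d))) e)) (difference≡0⇒≡ cs ds es)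

  InSpan-zero : ∀ {n k} (vs : Vec (V n) k) → InSpan vs zeroV
  InSpan-zero vs = zeroV , lincomb-zero vs

  InSpan-+ : ∀ {n k} {vs : Vec (V n) k} {x y} → InSpan vs x → InSpan vs y → InSpan vs (x +V y)
  InSpan-+ {vs = vs} (c , refl) (d , refl) = c +V d , lincomb-+ c d vs

  InSpan-· : ∀ {n k} {vs : Vec (V n) k} e {x} → InSpan vs x → InSpan vs (e · x)
  InSpan-· {vs = vs} e (c , refl) = e · c , lincomb-· e c vs

  InSpan-·⁻ : ∀ {n k} {vs : Vec (V n) k} l → l ≢ 0# → ∀ {x} → InSpan vs (l · x) → InSpan vs x
  InSpan-·⁻ l l≢0 {x} lx∈ = subst (InSpan _) (·-inv l l≢0 x) (InSpan-· (inv l l≢0) lx∈)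

  InSpan-mono : ∀ {n k l} {us : Vec (V n) k} {vs : Vec (V n) l} →
                VecAll.All (InSpan vs) us → ∀ {x} → InSpan us x → InSpan vs x
  InSpan-mono {us = []}     {vs} VecAll.[]         ([] , refl)     = InSpan-zero vs
  InSpan-mono {us = u ∷ us} (u∈ VecAll.∷ us∈) (c ∷ cs , refl) =
    InSpan-+ (InSpan-· c u∈) (InSpan-mono us∈ (cs , refl))

  InSpan-there : ∀ {n k} (w : V n) {ws : Vec (V n) k} {x} → InSpan ws x → InSpan (w ∷ ws) x
  InSpan-there w {ws} (c , refl) = 0# ∷ c , trans (cong (_+V lincomb c ws) (·-zeroˡ w)) (+V-identityˡ _)

  InSpan-here : ∀ {n k} (w : V n) (ws : Vec (V n) k) → InSpan (w ∷ ws) w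
  InSpan-here w ws = 1# ∷ zeroV , trans (cong₂ _+V_ (·-identityˡ w) (lincomb-zero ws)) (+V-identityʳ w)

  InSpan-self : ∀ {n k} (vs : Vec (V n) k) → VecAll.All (InSpan vs) vs
  InSpan-self []       = VecAll.[]
  InSpan-self (v ∷ vs) = InSpan-here v vs VecAll.∷ VecAll.map (InSpan-there v) (InSpan-self vs)

  InSpan? : ∀ {n k} (vs : Vec (V n) k) x → Dec (InSpan vs x)
  InSpan? {k = k} vs x = finite-∃? (Vec-cardinality k) (λ c → lincomb c vs ≟V x)

  ∃-outside-span : ∀ {n k l} (W : Vec (V n) k) (β : Vec (V n) l) → Independent W → l < k →
                   ∃ λ w → InSpan W w × ¬ InSpan β w
  ∃-outside-span {n} {k} {l} W β indW l<k
    with finite-∃? (Vec-cardinality k) (λ c → ¬? (InSpan? β (lincomb c W)))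
  ... | yes (c , ∉β) = lincomb c W , (c , refl) , ∉β
  ... | no ∄         = ⊥-elim (ℕₚ.<⇒≱ (ℕₚ.^-monoʳ-< size 2≤size l<k) (ℕₚ.≤-trans qᵏ≤|β| |β|≤qˡ))
    where
    W⊆β : ∀ {x} → InSpan W x → InSpan β x
    W⊆β (c , refl) = decidable-stable (InSpan? β (lincomb c W)) λ ∉β → ∄ (c , ∉β)
    |W| : HasSize (InSpan W) (size ^ k)
    |W| = HasSize-image (λ c → lincomb c W) (λ _ _ → lincomb-injective indW _ _)
            (λ {c} _ → c , refl) (λ (c , eq) → c , tt , eq) (Vec-cardinality k)
    |β| = HasSize-filter (Vec-cardinality (suc n)) (InSpan? β)
    qᵏ≤|β| : size ^ k ≤ proj₁ |β|
    qᵏ≤|β| = HasSize-onto⇒≤ (λ x → x) (λ x∈W → _ , W⊆β x∈W , refl) (proj₂ |β|) |W|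
    |β|≤qˡ : proj₁ |β| ≤ size ^ l
    |β|≤qˡ = HasSize-onto⇒≤ (λ d → lincomb d β) (λ (d , eq) → d , tt , eq) (Vec-cardinality l) (proj₂ |β|)

  norm : ∀ {m} → Vec F m → Vec F m
  norm []       = []
  norm (x ∷ xs) with x ≟ 0#
  ... | yes _   = x ∷ norm xs
  ... | no x≢0  = inv x x≢0 · (x ∷ xs)

  norm-scalar : ∀ {m} (v : Vec F m) → ∃ λ l → l ≢ 0# × norm v ≡ l · v
  norm-scalar []       = 1# , 1≢0 , refl
  norm-scalar (x ∷ xs) with x ≟ 0#
  ... | no x≢0  = inv x x≢0 , inv≢0 x x≢0 , refl
  ... | yes x≡0 with norm-scalar xs
  ...   | l , l≢0 , eq = l , l≢0 , cong₂ _∷_ (trans x≡0 (sym (trans (cong (l *_) x≡0) (zeroʳ l)))) eq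

  Normalized-norm : ∀ {m} (v : Vec F m) → v ≢ zeroV → Normalized (norm v)
  Normalized-norm []       v≢0 = ⊥-elim (v≢0 refl)
  Normalized-norm (x ∷ xs) v≢0 with x ≟ 0#
  ... | yes x≡0 = inj₂ (x≡0 , Normalized-norm xs (λ xs≡0 → v≢0 (cong₂ _∷_ x≡0 xs≡0)))
  ... | no x≢0  = inj₁ (inv-inverseˡ x x≢0)

  Normalized⇒≢zeroV : ∀ {m} {v : Vec F m} → Normalized v → v ≢ zeroV
  Normalized⇒≢zeroV {v = x ∷ xs} (inj₁ x≡1)        eq = 1≢0 (trans (sym x≡1) (Vecₚ.∷-injectiveˡ eq))
  Normalized⇒≢zeroV {v = x ∷ xs} (inj₂ (_ , nxs)) eq = Normalized⇒≢zeroV nxs (Vecₚ.∷-injectiveʳ eq)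

  Normalized-scalar≡1 : ∀ {m} {x y : Vec F m} l → Normalized x → Normalized y → x ≡ l · y → l ≡ 1#
  Normalized-scalar≡1 {x = x₀ ∷ xs} {y₀ ∷ ys} l nx (inj₁ y₀≡1) eq = case nx
    where
    l≡x₀ : l ≡ x₀
    l≡x₀ = trans (sym (*-identityʳ l)) (trans (cong (l *_) (sym y₀≡1)) (sym (Vecₚ.∷-injectiveˡ eq)))
    case : Normalized (x₀ ∷ xs) → l ≡ 1#
    case (inj₁ x₀≡1)         = trans l≡x₀ x₀≡1
    case (inj₂ (x₀≡0 , nxs)) = ⊥-elim (Normalized⇒≢zeroV nxs
      (trans (Vecₚ.∷-injectiveʳ eq) (trans (cong (_· ys) (trans l≡x₀ x₀≡0)) (·-zeroˡ ys))))
  Normalized-scalar≡1 {x = x₀ ∷ xs} {y₀ ∷ ys} l (inj₁ x₀≡1) (inj₂ (y₀≡0 , _)) eq =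
    ⊥-elim (1≢0 (trans (sym x₀≡1) (trans (Vecₚ.∷-injectiveˡ eq) (trans (cong (l *_) y₀≡0) (zeroʳ l)))))
  Normalized-scalar≡1 {x = x₀ ∷ xs} {y₀ ∷ ys} l (inj₂ (_ , nxs)) (inj₂ (_ , nys)) eq =
    Normalized-scalar≡1 l nxs nys (Vecₚ.∷-injectiveʳ eq)

  Normalized-proportional⇒≡ : ∀ {m} {x y : Vec F m} l → Normalized x → Normalized y → x ≡ l · y → x ≡ y
  Normalized-proportional⇒≡ {y = y} l nx ny eq =
    trans eq (trans (cong (_· y) (Normalized-scalar≡1 l nx ny eq)) (·-identityˡ y))

  norm-Normalized : ∀ {m} {v : Vec F m} → Normalized v → norm v ≡ v
  norm-Normalized {v = v} nv with norm-scalar v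
  ... | l , _ , eq = Normalized-proportional⇒≡ l (Normalized-norm v (Normalized⇒≢zeroV nv)) nv eq

  norm-· : ∀ {m} l (v : Vec F m) → l ≢ 0# → v ≢ zeroV → norm (l · v) ≡ norm v
  norm-· l v l≢0 v≢0 with norm-scalar (l · v) | norm-scalar v
  ... | μ , _ , eqₗᵥ | ν , ν≢0 , eqᵥ =
    Normalized-proportional⇒≡ ((μ * l) * inv ν ν≢0)
      (Normalized-norm (l · v) (·-≢zeroV l v l≢0 v≢0)) (Normalized-norm v v≢0) (begin
        norm (l · v)                          ≡⟨ trans eqₗᵥ (·-assoc μ l v) ⟩
        (μ * l) · v                           ≡⟨ cong ((μ * l) ·_) (sym (·-inv ν ν≢0 v)) ⟩
        (μ * l) · (inv ν ν≢0 · (ν · v))       ≡⟨ ·-assoc _ _ _ ⟩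
        ((μ * l) * inv ν ν≢0) · (ν · v)       ≡⟨ cong (((μ * l) * inv ν ν≢0) ·_) (sym eqᵥ) ⟩
        ((μ * l) * inv ν ν≢0) · norm v        ∎)

  Normalized? : ∀ {m} (v : Vec F m) → Dec (Normalized v)
  Normalized? []       = no (λ ())
  Normalized? (x ∷ xs) = (x ≟ 1#) ⊎-dec ((x ≟ 0#) ×-dec Normalized? xs)

  Independent-∷ : ∀ {n k} {vs : Vec (V n) k} {x} → Independent vs → ¬ InSpan vs x → Independent (x ∷ vs)
  Independent-∷ {vs = vs} {x} ind x∉ (c₀ ∷ cs) eq with c₀ ≟ 0#
  ... | yes c₀≡0 = c₀≡0 VecAll.∷ ind cs (trans (sym (+V-identityˡ _)) (trans (cong (_+V lincomb cs vs) (sym c₀x≡0)) eq))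
    where
    c₀x≡0 : c₀ · x ≡ zeroV
    c₀x≡0 = trans (cong (_· x) c₀≡0) (·-zeroˡ x)
  ... | no c₀≢0 = ⊥-elim (x∉ (InSpan-·⁻ c₀ c₀≢0 (subst (InSpan vs) (sym c₀x≡-L) (InSpan-· (- 1#) (cs , refl)))))
    where
    L = lincomb cs vs
    c₀x≡-L : c₀ · x ≡ (- 1#) · L
    c₀x≡-L = +V-cancelʳ L _ _ (trans eq (sym (trans (+V-comm _ L) (+V-inverseʳ L))))

  Independent⇒head≢0 : ∀ {n k} (vs : Vec (V n) (suc k)) → Independent vs → Vec.lookup vs Fin.zero ≢ zeroV
  Independent⇒head≢0 (v ∷ vs) ind v≡0 with ind (1# ∷ zeroV) (trans (proj₂ (InSpan-here v vs)) v≡0)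
  ... | 1≡0 VecAll.∷ _ = 1≢0 1≡0

  lincomb-removeAt : ∀ {n k} (d : Vec F (suc k)) (W : Vec (V n) (suc k)) j →
                     lincomb d W ≡ (Vec.lookup d j · Vec.lookup W j) +V lincomb (Vec.removeAt d j) (Vec.removeAt W j)
  lincomb-removeAt (d ∷ ds)      (w ∷ ws)      Fin.zero    = refl
  lincomb-removeAt (d ∷ d′ ∷ ds) (w ∷ w′ ∷ ws) (Fin.suc j) = begin
    (d · w) +V lincomb (d′ ∷ ds) (w′ ∷ ws) ≡⟨ cong ((d · w) +V_) (lincomb-removeAt (d′ ∷ ds) (w′ ∷ ws) j) ⟩
    (d · w) +V (X +V R)                    ≡⟨ sym (+V-assoc _ X R) ⟩
    ((d · w) +V X) +V R                    ≡⟨ cong (_+V R) (+V-comm _ X) ⟩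
    (X +V (d · w)) +V R                    ≡⟨ +V-assoc X _ R ⟩
    X +V ((d · w) +V R)                    ∎
    where
    X = Vec.lookup (d′ ∷ ds) j · Vec.lookup (w′ ∷ ws) j
    R = lincomb (Vec.removeAt (d′ ∷ ds) j) (Vec.removeAt (w′ ∷ ws) j)

  weightedSum : ∀ {n k} (g : V n → F) → Vec F k → Vec (V n) k → F
  weightedSum g []       []       = 0#
  weightedSum g (c ∷ cs) (w ∷ ws) = c * g w + weightedSum g cs ws

  lincomb-shift : ∀ {n k} (g : V n → F) (b : V n) (c : Vec F k) ws →
                  lincomb c (Vec.map (λ w → w +V (g w · b)) ws) ≡ lincomb c ws +V (weightedSum g c ws · b)
  lincomb-shift g b []       []       = sym (trans (cong (zeroV +V_) (·-zeroˡ b)) (+V-identityˡ zeroV))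
  lincomb-shift g b (c ∷ cs) (w ∷ ws) = begin
    (c · (w +V (g w · b))) +V lincomb cs (Vec.map _ ws)
      ≡⟨ cong₂ _+V_ (trans (·-distribˡ c w _) (cong ((c · w) +V_) (·-assoc c (g w) b))) (lincomb-shift g b cs ws) ⟩
    ((c · w) +V ((c * g w) · b)) +V (lincomb cs ws +V (weightedSum g cs ws · b))
      ≡⟨ +V-interchange _ _ _ _ ⟩
    ((c · w) +V lincomb cs ws) +V (((c * g w) · b) +V (weightedSum g cs ws · b))
      ≡⟨ cong (((c · w) +V lincomb cs ws) +V_) (sym (·-distribʳ _ _ b)) ⟩
    ((c · w) +V lincomb cs ws) +V ((c * g w + weightedSum g cs ws) · b) ∎

  InSpan-self-rotate : ∀ {n r l} (u : V n) (us : Vec (V n) r) (vs : Vec (V n) l) →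
                       VecAll.All (InSpan (us Vec.++ (u ∷ vs))) (u ∷ (us Vec.++ vs))
  InSpan-self-rotate u us vs with VecAllₚ.++⁻ us (InSpan-self (us Vec.++ (u ∷ vs)))
  ... | us∈ , (u∈ VecAll.∷ vs∈) = u∈ VecAll.∷ VecAllₚ.++⁺ us∈ vs∈

module QuadraticForm (K : FiniteField) {n : ℕ} (a : Geometry.QMat K n) where
  open VectorSpace K public
  open ≡-Reasoning

  dot : ∀ {m} → Vec F m → Vec F m → F
  dot r x = sumV (zipWith _*_ r x)

  dot-+ : ∀ {m} (r x y : Vec F m) → dot r (x +V y) ≡ dot r x + dot r y
  dot-+ []       []       []       = sym (+-identityˡ 0#)
  dot-+ (r ∷ rs) (x ∷ xs) (y ∷ ys) = begin
    r * (x + y) + dot rs (xs +V ys)           ≡⟨ cong₂ _+_ (distribˡ r x y) (dot-+ rs xs ys) ⟩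
    (r * x + r * y) + (dot rs xs + dot rs ys) ≡⟨ +-interchange _ _ _ _ ⟩
    (r * x + dot rs xs) + (r * y + dot rs ys) ∎

  dot-· : ∀ {m} (r x : Vec F m) c → dot r (c · x) ≡ c * dot r x
  dot-· []       []       c = sym (zeroʳ c)
  dot-· (r ∷ rs) (x ∷ xs) c = begin
    r * (c * x) + dot rs (c · xs) ≡⟨ cong₂ _+_ (x*yz≡y*xz r c x) (dot-· rs xs c) ⟩
    c * (r * x) + c * dot rs xs   ≡⟨ sym (distribˡ c _ _) ⟩
    c * (r * x + dot rs xs)       ∎

  -- Q a x is form a x x by definition; polar below symmetrises this non-symmetric bilinear form.
  form : ∀ {m} → Vec (V n) m → Vec F m → V n → F
  form rows x z = sumV (zipWith (λ row xᵢ → xᵢ * dot row z) rows x)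

  form-+ˡ : ∀ {m} (rows : Vec (V n) m) x y z → form rows (x +V y) z ≡ form rows x z + form rows y z
  form-+ˡ []       []       []       z = sym (+-identityˡ 0#)
  form-+ˡ (r ∷ rs) (x ∷ xs) (y ∷ ys) z = begin
    (x + y) * dot r z + form rs (xs +V ys) z
      ≡⟨ cong₂ _+_ (distribʳ (dot r z) x y) (form-+ˡ rs xs ys z) ⟩
    (x * dot r z + y * dot r z) + (form rs xs z + form rs ys z)
      ≡⟨ +-interchange _ _ _ _ ⟩
    (x * dot r z + form rs xs z) + (y * dot r z + form rs ys z) ∎

  form-·ˡ : ∀ {m} (rows : Vec (V n) m) x c z → form rows (c · x) z ≡ c * form rows x z
  form-·ˡ []       []       c z = sym (zeroʳ c)
  form-·ˡ (r ∷ rs) (x ∷ xs) c z = begin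
    (c * x) * dot r z + form rs (c · xs) z ≡⟨ cong₂ _+_ (*-assoc c x _) (form-·ˡ rs xs c z) ⟩
    c * (x * dot r z) + c * form rs xs z   ≡⟨ sym (distribˡ c _ _) ⟩
    c * (x * dot r z + form rs xs z)       ∎

  form-+ʳ : ∀ {m} (rows : Vec (V n) m) x z w → form rows x (z +V w) ≡ form rows x z + form rows x w
  form-+ʳ []       []       z w = sym (+-identityˡ 0#)
  form-+ʳ (r ∷ rs) (x ∷ xs) z w = begin
    x * dot r (z +V w) + form rs xs (z +V w)
      ≡⟨ cong₂ _+_ (trans (cong (x *_) (dot-+ r z w)) (distribˡ x _ _)) (form-+ʳ rs xs z w) ⟩
    (x * dot r z + x * dot r w) + (form rs xs z + form rs xs w)
      ≡⟨ +-interchange _ _ _ _ ⟩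
    (x * dot r z + form rs xs z) + (x * dot r w + form rs xs w) ∎

  form-·ʳ : ∀ {m} (rows : Vec (V n) m) x c z → form rows x (c · z) ≡ c * form rows x z
  form-·ʳ []       []       c z = sym (zeroʳ c)
  form-·ʳ (r ∷ rs) (x ∷ xs) c z = begin
    x * dot r (c · z) + form rs xs (c · z)
      ≡⟨ cong₂ _+_ (trans (cong (x *_) (dot-· r z c)) (x*yz≡y*xz x c _)) (form-·ʳ rs xs c z) ⟩
    c * (x * dot r z) + c * form rs xs z   ≡⟨ sym (distribˡ c _ _) ⟩
    c * (x * dot r z + form rs xs z)       ∎

  polar : V n → V n → F
  polar x y = form a x y + form a y x

  polar-sym : ∀ x y → polar x y ≡ polar y x
  polar-sym x y = +-comm _ _

  Q-+ : ∀ x y → Q a (x +V y) ≡ (Q a x + Q a y) + polar x y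
  Q-+ x y = begin
    form a (x +V y) (x +V y)                          ≡⟨ form-+ˡ a x y (x +V y) ⟩
    form a x (x +V y) + form a y (x +V y)             ≡⟨ cong₂ _+_ (form-+ʳ a x x y) (form-+ʳ a y x y) ⟩
    (form a x x + form a x y) + (form a y x + form a y y)
      ≡⟨ solve 4 (λ p q r s → ((p ⊕ q) ⊕ (r ⊕ s)) ⊜ ((p ⊕ s) ⊕ (q ⊕ r))) refl _ _ _ _ ⟩
    (form a x x + form a y y) + (form a x y + form a y x) ∎

  B≡polar : ∀ x y → B a x y ≡ polar x y
  B≡polar x y = begin
    ((Q a (x +V y)) + - Q a x) + - Q a y                 ≡⟨ cong (λ t → (t + - Q a x) + - Q a y) (Q-+ x y) ⟩
    (((Q a x + Q a y) + polar x y) + - Q a x) + - Q a y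
      ≡⟨ solve 5 (λ p q r p′ q′ → ((((p ⊕ q) ⊕ r) ⊕ p′) ⊕ q′) ⊜ (r ⊕ ((p ⊕ p′) ⊕ (q ⊕ q′))))
               refl (Q a x) (Q a y) (polar x y) (- Q a x) (- Q a y) ⟩
    polar x y + ((Q a x + - Q a x) + (Q a y + - Q a y))
      ≡⟨ cong (polar x y +_) (cong₂ _+_ (-‿inverseʳ (Q a x)) (-‿inverseʳ (Q a y))) ⟩
    polar x y + (0# + 0#)                                 ≡⟨ trans (cong (polar x y +_) (+-identityˡ 0#)) (+-identityʳ _) ⟩
    polar x y                                             ∎

  Q-· : ∀ c x → Q a (c · x) ≡ (c * c) * Q a x
  Q-· c x = begin
    form a (c · x) (c · x) ≡⟨ form-·ˡ a x c (c · x) ⟩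
    c * form a x (c · x)   ≡⟨ cong (c *_) (form-·ʳ a x c x) ⟩
    c * (c * form a x x)   ≡⟨ sym (*-assoc c c _) ⟩
    (c * c) * Q a x        ∎

  polar-+ʳ : ∀ x y z → polar x (y +V z) ≡ polar x y + polar x z
  polar-+ʳ x y z = trans (cong₂ _+_ (form-+ʳ a x y z) (form-+ˡ a y z x)) (+-interchange _ _ _ _)

  polar-·ʳ : ∀ x c y → polar x (c · y) ≡ c * polar x y
  polar-·ʳ x c y = trans (cong₂ _+_ (form-·ʳ a x c y) (form-·ˡ a y c x)) (sym (distribˡ c _ _))

  polar-+ˡ : ∀ x y z → polar (x +V y) z ≡ polar x z + polar y z
  polar-+ˡ x y z = trans (polar-sym _ _) (trans (polar-+ʳ z x y) (cong₂ _+_ (polar-sym z x) (polar-sym z y)))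

  polar-·ˡ : ∀ c x y → polar (c · x) y ≡ c * polar x y
  polar-·ˡ c x y = trans (polar-sym _ _) (trans (polar-·ʳ y c x) (cong (c *_) (polar-sym y x)))

  polar-zeroʳ : ∀ x → polar x zeroV ≡ 0#
  polar-zeroʳ x = trans (cong (polar x) (sym (·-zeroˡ zeroV))) (trans (polar-·ʳ x 0# zeroV) (zeroˡ _))

  polar-InSpan : ∀ {k} x (vs : Vec (V n) k) → VecAll.All (λ v → polar x v ≡ 0#) vs →
                 ∀ {y} → InSpan vs y → polar x y ≡ 0#
  polar-InSpan x []       VecAll.[]            ([] , refl)     = polar-zeroʳ x
  polar-InSpan x (v ∷ vs) (x⊥v VecAll.∷ x⊥vs) (c ∷ cs , refl) = begin
    polar x ((c · v) +V lincomb cs vs)         ≡⟨ polar-+ʳ x _ _ ⟩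
    polar x (c · v) + polar x (lincomb cs vs)  ≡⟨ cong₂ _+_ (polar-·ʳ x c v) (polar-InSpan x vs x⊥vs (cs , refl)) ⟩
    c * polar x v + 0#                         ≡⟨ trans (+-identityʳ _) (trans (cong (c *_) x⊥v) (zeroʳ c)) ⟩
    0#                                          ∎

  ContainedIn⇒Q≡0 : ∀ {k} {vs : Vec (V n) k} → ContainedIn a vs → ∀ {x} → InSpan vs x → Q a x ≡ 0#
  ContainedIn⇒Q≡0 vs⊆Q (c , refl) = vs⊆Q c

  ContainedIn⇒polar≡0 : ∀ {k} {vs : Vec (V n) k} → ContainedIn a vs →
                        ∀ {x y} → InSpan vs x → InSpan vs y → polar x y ≡ 0#
  ContainedIn⇒polar≡0 vs⊆Q {x} {y} x∈ y∈ = begin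
    polar x y                         ≡⟨ sym (+-identityˡ _) ⟩
    0# + polar x y                    ≡⟨ cong (_+ polar x y) (sym (trans (cong₂ _+_ Qx≡0 Qy≡0) (+-identityˡ 0#))) ⟩
    (Q a x + Q a y) + polar x y       ≡⟨ sym (Q-+ x y) ⟩
    Q a (x +V y)                      ≡⟨ ContainedIn⇒Q≡0 vs⊆Q (InSpan-+ x∈ y∈) ⟩
    0#                                ∎
    where
    Qx≡0 = ContainedIn⇒Q≡0 vs⊆Q x∈
    Qy≡0 = ContainedIn⇒Q≡0 vs⊆Q y∈

  Q-combination : ∀ l m x y → Q a ((l · x) +V (m · y)) ≡ ((l * l) * Q a x + (m * m) * Q a y) + (l * m) * polar x y
  Q-combination l m x y = begin
    Q a ((l · x) +V (m · y))                          ≡⟨ Q-+ _ _ ⟩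
    (Q a (l · x) + Q a (m · y)) + polar (l · x) (m · y)
      ≡⟨ cong₂ _+_ (cong₂ _+_ (Q-· l x) (Q-· m y))
                   (trans (polar-·ˡ l x _) (trans (cong (l *_) (polar-·ʳ x m y)) (sym (*-assoc l m _)))) ⟩
    ((l * l) * Q a x + (m * m) * Q a y) + (l * m) * polar x y ∎

  ContainedIn-∷ : ∀ {k} {vs : Vec (V n) k} {x} → ContainedIn a vs → Q a x ≡ 0# →
                  VecAll.All (λ v → polar v x ≡ 0#) vs → ContainedIn a (x ∷ vs)
  ContainedIn-∷ {vs = vs} {x} vs⊆Q Qx≡0 vs⊥x (c₀ ∷ cs) = begin
    Q a ((c₀ · x) +V L)                         ≡⟨ Q-+ _ _ ⟩
    (Q a (c₀ · x) + Q a L) + polar (c₀ · x) L   ≡⟨ cong₂ (λ u w → (u + Q a L) + w) Qc₀x≡0 c₀x⊥L ⟩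
    (0# + Q a L) + 0#                           ≡⟨ trans (+-identityʳ _) (trans (+-identityˡ _) (vs⊆Q cs)) ⟩
    0#                                           ∎
    where
    L = lincomb cs vs
    Qc₀x≡0 : Q a (c₀ · x) ≡ 0#
    Qc₀x≡0 = trans (Q-· c₀ x) (trans (cong ((c₀ * c₀) *_) Qx≡0) (zeroʳ _))
    c₀x⊥L : polar (c₀ · x) L ≡ 0#
    c₀x⊥L = trans (polar-·ˡ c₀ x L)
      (trans (cong (c₀ *_) (polar-InSpan x vs (VecAll.map (trans (polar-sym _ _)) vs⊥x) (cs , refl))) (zeroʳ c₀))

  ∃-singular-nonorthogonal : NonSingular a → ∀ {v} → v ≢ zeroV → Q a v ≡ 0# →
                             ∃ λ y → Q a y ≡ 0# × polar v y ≢ 0#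
  ∃-singular-nonorthogonal nonsing {v} v≢0 Qv≡0
    with finite-∃? (Vec-cardinality (suc n)) (λ z → ¬? (polar v z ≟ 0#))
  ... | no ∄ = ⊥-elim (nonsing v v≢0 Qv≡0 λ z →
    trans (B≡polar v z) (decidable-stable (polar v z ≟ 0#) λ vz≢0 → ∄ (z , vz≢0)))
  ... | yes (z , vz≢0) = z +V (k · v) , Qy≡0 , λ vy≡0 → vz≢0 (trans (sym vy≡vz) vy≡0)
    where
    k = - (Q a z * inv (polar v z) vz≢0)
    vv≡0 : polar v v ≡ 0#
    vv≡0 = trans (cong₂ _+_ Qv≡0 Qv≡0) (+-identityˡ 0#)
    Qy≡0 : Q a (z +V (k · v)) ≡ 0#
    Qy≡0 = begin
      Q a (z +V (k · v))                          ≡⟨ Q-+ z _ ⟩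
      (Q a z + Q a (k · v)) + polar z (k · v)
        ≡⟨ cong₂ (λ u w → (Q a z + u) + w) (trans (Q-· k v) (trans (cong ((k * k) *_) Qv≡0) (zeroʳ _)))
                 (trans (polar-·ʳ z k v) (cong (k *_) (polar-sym z v))) ⟩
      (Q a z + 0#) + k * polar v z                ≡⟨ cong (_+ k * polar v z) (+-identityʳ _) ⟩
      Q a z + k * polar v z                       ≡⟨ +-*-inv-cancel (polar v z) vz≢0 (Q a z) ⟩
      0#                                           ∎
    vy≡vz : polar v (z +V (k · v)) ≡ polar v z
    vy≡vz = trans (polar-+ʳ v z _)
      (trans (cong (polar v z +_) (trans (polar-·ʳ v k v) (trans (cong (k *_) vv≡0) (zeroʳ k)))) (+-identityʳ _))

  -- polar a′ b ≢ 0 makes (a′, b) a hyperbolic pair: projecting α′ and β onto b⊥ along a′, and the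
  -- rest of W onto a′⊥ along b, lowers both the number of constraints and the dimension of W by one.
  module HyperbolicReduction {r l k} (a′ : V n) (α′ : Vec (V n) r) (β : Vec (V n) l)
    (W : Vec (V n) (suc k)) (indW : Independent W) (W⊆Q : ContainedIn a W)
    (j : Fin (suc k)) (a′b≢0 : polar a′ (Vec.lookup W j) ≢ 0#) where

    b = Vec.lookup W j
    i = inv (polar a′ b) a′b≢0

    κ τ : V n → F
    κ v = - (polar v b * i)
    τ w = - (polar a′ w * i)

    along-a′ along-b : V n → V n
    along-a′ v = v +V (κ v · a′)
    along-b  w = w +V (τ w · b)

    W′ = Vec.map along-b (Vec.removeAt W j)
    α″ = Vec.map along-a′ α′
    β″ = Vec.map along-a′ β

    polar-along-a′ : ∀ v → polar (along-a′ v) b ≡ 0#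
    polar-along-a′ v = trans (polar-+ˡ v _ b)
      (trans (cong (polar v b +_) (polar-·ˡ (κ v) a′ b)) (+-*-inv-cancel _ a′b≢0 (polar v b)))

    polar-along-b : ∀ w → polar a′ (along-b w) ≡ 0#
    polar-along-b w = trans (polar-+ʳ a′ w _)
      (trans (cong (polar a′ w +_) (polar-·ʳ a′ (τ w) b)) (+-*-inv-cancel _ a′b≢0 (polar a′ w)))

    b∈W : InSpan W b
    b∈W = VecAllₚ.lookup⁺ (InSpan-self W) j

    W′⊆W : VecAll.All (InSpan W) W′
    W′⊆W = VecAllₚ.map⁺ (VecAll.map (λ {w} w∈ → InSpan-+ w∈ (InSpan-· (τ w) b∈W))
                                    (All-removeAt W j (InSpan-self W)))

    W′⊆Q : ContainedIn a W′
    W′⊆Q c = ContainedIn⇒Q≡0 W⊆Q (InSpan-mono W′⊆W (c , refl))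

    indW′ : Independent W′
    indW′ c eq = subst (VecAll.All (_≡ 0#)) (Vecₚ.removeAt-insertAt c j S) (All-removeAt d j (indW d d·W≡0))
      where
      S = weightedSum τ c (Vec.removeAt W j)
      d = Vec.insertAt c j S
      d·W≡0 : lincomb d W ≡ zeroV
      d·W≡0 = begin
        lincomb d W
          ≡⟨ lincomb-removeAt d W j ⟩
        (Vec.lookup d j · b) +V lincomb (Vec.removeAt d j) (Vec.removeAt W j)
          ≡⟨ cong₂ (λ u z → (u · b) +V lincomb z (Vec.removeAt W j))
                   (Vecₚ.insertAt-lookup c j S) (Vecₚ.removeAt-insertAt c j S) ⟩
        (S · b) +V lincomb c (Vec.removeAt W j)
          ≡⟨ +V-comm _ _ ⟩
        lincomb c (Vec.removeAt W j) +V (S · b)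
          ≡⟨ sym (lincomb-shift τ b c (Vec.removeAt W j)) ⟩
        lincomb c W′
          ≡⟨ eq ⟩
        zeroV ∎

    InSpan-W′⇒⊥a′ : ∀ {w} → InSpan W′ w → polar a′ w ≡ 0#
    InSpan-W′⇒⊥a′ = polar-InSpan a′ W′ (VecAllₚ.map⁺ (VecAll.universal polar-along-b _))

    along-a′-⊥⁻ : ∀ {w} → polar a′ w ≡ 0# → ∀ {v} → polar (along-a′ v) w ≡ 0# → polar v w ≡ 0#
    along-a′-⊥⁻ {w} a′⊥w {v} eq = begin
      polar v w                      ≡⟨ sym (+-identityʳ _) ⟩
      polar v w + 0#                 ≡⟨ cong (polar v w +_) (sym (trans (cong (κ v *_) a′⊥w) (zeroʳ _))) ⟩
      polar v w + κ v * polar a′ w   ≡⟨ cong (polar v w +_) (sym (polar-·ˡ (κ v) a′ w)) ⟩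
      polar v w + polar (κ v · a′) w ≡⟨ sym (polar-+ˡ v _ w) ⟩
      polar (along-a′ v) w           ≡⟨ eq ⟩
      0#                             ∎

    a′α′β⊆ : VecAll.All (InSpan (a′ ∷ (α″ Vec.++ β″))) (a′ ∷ (α′ Vec.++ β))
    a′α′β⊆ with VecAllₚ.++⁻ α″ (InSpan-self (α″ Vec.++ β″))
    ... | α″∈ , β″∈ = InSpan-here a′ _ VecAll.∷
      VecAllₚ.++⁺ (VecAll.map unproject (VecAllₚ.map⁻ α″∈)) (VecAll.map unproject (VecAllₚ.map⁻ β″∈))
      where
      unproject : ∀ {v} → InSpan (α″ Vec.++ β″) (along-a′ v) → InSpan (a′ ∷ (α″ Vec.++ β″)) v
      unproject {v} v′∈ = subst (InSpan _) (x+u-u≡x v (κ v · a′))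
        (InSpan-+ (InSpan-there a′ v′∈) (InSpan-· (- 1#) (InSpan-· (κ v) (InSpan-here a′ _))))

    b⊥α″β″ : VecAll.All (λ v → polar b v ≡ 0#) (α″ Vec.++ β″)
    b⊥α″β″ = VecAllₚ.++⁺ (VecAllₚ.map⁺ (VecAll.universal b⊥ α′)) (VecAllₚ.map⁺ (VecAll.universal b⊥ β))
      where
      b⊥ : ∀ v → polar b (along-a′ v) ≡ 0#
      b⊥ v = trans (polar-sym _ _) (polar-along-a′ v)

    -- pairing with b kills the α″ ++ β″ part and leaves the a′-coefficient times polar a′ b
    ∉span : ∀ {w} → InSpan W w → ¬ InSpan (α″ Vec.++ β″) w → ¬ InSpan (a′ ∷ (α′ Vec.++ β)) w
    ∉span {w} w∈W w∉ w∈ with InSpan-mono a′α′β⊆ w∈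
    ... | c₀ ∷ cs , eq = w∉ (cs , trans (sym c₀a′+L≡L) eq)
      where
      L = lincomb cs (α″ Vec.++ β″)
      c₀≡0 : c₀ ≡ 0#
      c₀≡0 = x*y≡0⇒y≡0 (polar a′ b) c₀ a′b≢0 (trans (*-comm _ c₀) (begin
        c₀ * polar a′ b                     ≡⟨ sym (+-identityʳ _) ⟩
        c₀ * polar a′ b + 0#
          ≡⟨ cong (c₀ * polar a′ b +_) (sym (trans (polar-sym L b) (polar-InSpan b _ b⊥α″β″ (cs , refl)))) ⟩
        c₀ * polar a′ b + polar L b         ≡⟨ cong (_+ polar L b) (sym (polar-·ˡ c₀ a′ b)) ⟩
        polar (c₀ · a′) b + polar L b       ≡⟨ sym (polar-+ˡ _ L b) ⟩
        polar ((c₀ · a′) +V L) b            ≡⟨ cong (λ z → polar z b) eq ⟩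
        polar w b                           ≡⟨ ContainedIn⇒polar≡0 W⊆Q w∈W b∈W ⟩
        0#                                  ∎))
      c₀a′+L≡L : (c₀ · a′) +V L ≡ L
      c₀a′+L≡L = trans (cong (_+V L) (trans (cong (_· a′) c₀≡0) (·-zeroˡ a′))) (+V-identityˡ L)

    lift : (∃ λ w → InSpan W′ w × VecAll.All (λ v → polar v w ≡ 0#) α″ × ¬ InSpan (α″ Vec.++ β″) w) →
           ∃ λ w → InSpan W w × VecAll.All (λ v → polar v w ≡ 0#) (a′ ∷ α′) × ¬ InSpan (a′ ∷ (α′ Vec.++ β)) w
    lift (w , w∈W′ , w⊥α″ , w∉) =
      w , w∈W , a′⊥w VecAll.∷ VecAll.map (along-a′-⊥⁻ a′⊥w) (VecAllₚ.map⁻ w⊥α″) , ∉span w∈W w∉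
      where
      w∈W = InSpan-mono W′⊆W w∈W′
      a′⊥w = InSpan-W′⇒⊥a′ w∈W′

  -- β holds vectors to be avoided but not necessarily orthogonal to; it is what lets the induction through.
  ∃-orthogonal-outside-span : ∀ {r l k} (α : Vec (V n) r) (β : Vec (V n) l) (W : Vec (V n) k) →
    Independent W → ContainedIn a W → r ℕ.+ l < k →
    ∃ λ w → InSpan W w × VecAll.All (λ v → polar v w ≡ 0#) α × ¬ InSpan (α Vec.++ β) w
  ∃-orthogonal-outside-span [] β W indW _ l<k with ∃-outside-span W β indW l<k
  ... | w , w∈W , w∉β = w , w∈W , VecAll.[] , w∉β
  ∃-orthogonal-outside-span {suc r} {l} {suc k} (a′ ∷ α′) β W indW W⊆Q r+l<k
    with All⊎∃¬ (λ w → polar a′ w ≟ 0#) W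
  ... | inj₂ (j , a′b≢0) = lift (∃-orthogonal-outside-span α″ β″ W′ indW′ W′⊆Q (ℕₚ.≤-pred r+l<k))
    where open HyperbolicReduction a′ α′ β W indW W⊆Q j a′b≢0
  ... | inj₁ a′⊥W with ∃-orthogonal-outside-span α′ (a′ ∷ β) W indW W⊆Q
                         (subst (_< suc k) (sym (ℕₚ.+-suc r l)) r+l<k)
  ...   | w , w∈W , w⊥α′ , w∉ =
    w , w∈W , polar-InSpan a′ W a′⊥W w∈W VecAll.∷ w⊥α′ ,
    λ w∈ → w∉ (InSpan-mono (InSpan-self-rotate a′ α′ β) w∈)

module PointTypes (K : FiniteField) {n : ℕ} (a : Geometry.QMat K n) {s : ℕ}
  (α : Vec (Geometry.V K n) (suc s)) (indα : Geometry.Independent K α) (α⊆Q : Geometry.ContainedIn K a α) where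
  open QuadraticForm K a public
  open ≡-Reasoning

  Perp : V n → Set
  Perp x = VecAll.All (λ v → polar v x ≡ 0#) α

  Perp-InSpan : ∀ {x} → Perp x → ∀ {v} → InSpan α v → polar v x ≡ 0#
  Perp-InSpan x⊥α v∈ = trans (polar-sym _ _) (polar-InSpan _ α (VecAll.map (trans (polar-sym _ _)) x⊥α) v∈)

  InSpan⇒Perp : ∀ {x} → InSpan α x → Perp x
  InSpan⇒Perp x∈ = VecAll.map (λ v∈ → ContainedIn⇒polar≡0 α⊆Q v∈ x∈) (InSpan-self α)

  QPoint? : ∀ x → Dec (QPoint a x)
  QPoint? x = Normalized? x ×-dec (Q a x ≟ 0#)

  QPoint-norm : ∀ {v} → v ≢ zeroV → Q a v ≡ 0# → QPoint a (norm v)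
  QPoint-norm {v} v≢0 Qv≡0 with norm-scalar v
  ... | l , _ , eq = Normalized-norm v v≢0 , trans (cong (Q a) eq) (trans (Q-· l v) (trans (cong (_ *_) Qv≡0) (zeroʳ _)))

  -- TypeII asks for a whole (s+1)-space Π; the span of x ∷ α is always a valid choice.
  TypeII⇔ : ∀ {x} → TypeII a α x ⇔ (QPoint a x × ¬ InSpan α x × Perp x)
  TypeII⇔ {x} = mk⇔
    (λ (qx , x∉α , Π , _ , Π⊆Q , α⊆Π , x∈Π) →
      qx , x∉α , VecAll.map (λ v∈α → ContainedIn⇒polar≡0 Π⊆Q (α⊆Π _ v∈α) x∈Π) (InSpan-self α))
    (λ (qx , x∉α , x⊥α) →
      qx , x∉α , x ∷ α , Independent-∷ indα x∉α , ContainedIn-∷ α⊆Q (proj₂ qx) x⊥α ,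
      (λ _ → InSpan-there x) , InSpan-here x α)

  TypeII? : ∀ x → Dec (TypeII a α x)
  TypeII? x = map′ (Equivalence.from TypeII⇔) (Equivalence.to TypeII⇔)
    (QPoint? x ×-dec (¬? (InSpan? α x) ×-dec VecAll.all? (λ v → polar v x ≟ 0#) α))

  TypeII-norm : ∀ {w} → Q a w ≡ 0# → ¬ InSpan α w → Perp w → TypeII a α (norm w)
  TypeII-norm {w} Qw≡0 w∉α w⊥α with norm-scalar w
  ... | l , l≢0 , eq = Equivalence.from TypeII⇔
    ( QPoint-norm (λ w≡0 → w∉α (subst (InSpan α) (sym w≡0) (InSpan-zero α))) Qw≡0
    , (λ nw∈α → w∉α (InSpan-·⁻ l l≢0 (subst (InSpan α) eq nw∈α)))
    , subst Perp (sym eq) (VecAll.map (λ vw≡0 → trans (polar-·ʳ _ l _) (trans (cong (l *_) vw≡0) (zeroʳ l))) w⊥α))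

  Adjacent⇔ : ∀ {y x} → Adjacent a y x ⇔ (QPoint a y × QPoint a x × y ≢ x × polar y x ≡ 0#)
  Adjacent⇔ {y} {x} = mk⇔
    (λ (qy , qx , y≢x , line⊆Q) → qy , qx , y≢x , line⊆Q⇒polar≡0 qy qx (line⊆Q 1# 1#))
    (λ (qy , qx , y≢x , yx≡0) → qy , qx , y≢x , λ l m → polar≡0⇒line⊆Q qy qx yx≡0 l m)
    where
    Qₗₘ≡0 : ∀ l m → QPoint a y → QPoint a x → (l * l) * Q a y + (m * m) * Q a x ≡ 0#
    Qₗₘ≡0 l m (_ , Qy≡0) (_ , Qx≡0) =
      trans (cong₂ _+_ (trans (cong (_ *_) Qy≡0) (zeroʳ _)) (trans (cong (_ *_) Qx≡0) (zeroʳ _))) (+-identityˡ 0#)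

    line⊆Q⇒polar≡0 : QPoint a y → QPoint a x → Q a ((1# · y) +V (1# · x)) ≡ 0# → polar y x ≡ 0#
    line⊆Q⇒polar≡0 qy qx Q₁₁≡0 = begin
      polar y x                                                        ≡⟨ sym (trans (+-identityˡ _) (*-identityˡ _)) ⟩
      0# + 1# * polar y x
        ≡⟨ cong₂ (λ u w → u + w * polar y x) (sym (Qₗₘ≡0 1# 1# qy qx)) (sym (*-identityˡ 1#)) ⟩
      ((1# * 1#) * Q a y + (1# * 1#) * Q a x) + (1# * 1#) * polar y x ≡⟨ sym (Q-combination 1# 1# y x) ⟩
      Q a ((1# · y) +V (1# · x))                                       ≡⟨ Q₁₁≡0 ⟩
      0#                                                                ∎

    polar≡0⇒line⊆Q : QPoint a y → QPoint a x → polar y x ≡ 0# → ∀ l m → Q a ((l · y) +V (m · x)) ≡ 0#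
    polar≡0⇒line⊆Q qy qx yx≡0 l m = begin
      Q a ((l · y) +V (m · x))                                  ≡⟨ Q-combination l m y x ⟩
      ((l * l) * Q a y + (m * m) * Q a x) + (l * m) * polar y x ≡⟨ cong₂ _+_ (Qₗₘ≡0 l m qy qx) (trans (cong (_ *_) yx≡0) (zeroʳ _)) ⟩
      0# + 0#                                                    ≡⟨ +-identityˡ 0# ⟩
      0#                                                         ∎

  Adjacent? : ∀ y x → Dec (Adjacent a y x)
  Adjacent? y x = map′ (Equivalence.from Adjacent⇔) (Equivalence.to Adjacent⇔)
    (QPoint? y ×-dec (QPoint? x ×-dec (¬? (y ≟V x) ×-dec (polar y x ≟ 0#))))

  Neighbours : V n → V n → Set
  Neighbours y x = 𝒳 a α x × Adjacent a y x

  Neighbours? : ∀ y → Decidable (Neighbours y)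
  Neighbours? y x = TypeII? x ×-dec Adjacent? y x

  Perp-+ : ∀ {x y} → Perp x → Perp y → Perp (x +V y)
  Perp-+ {x} {y} x⊥α y⊥α = VecAll.map (λ {v} (vx≡0 , vy≡0) → trans (polar-+ʳ v x y)
    (trans (cong₂ _+_ vx≡0 vy≡0) (+-identityˡ 0#))) (VecAll.zip (x⊥α , y⊥α))

  module Shift (y p : V n) (p∈α : InSpan α p) (yp≡1 : polar y p ≡ 1#) where

    shift : F → V n → V n
    shift t x = norm (x +V (t · p))

    ·-shift : ∀ l x t → l · (x +V (t · p)) ≡ (l · x) +V ((l * t) · p)
    ·-shift l x t = trans (·-distribˡ l x _) (cong ((l · x) +V_) (·-assoc l t p))

    shift-TypeII : ∀ t {x} → TypeII a α x → TypeII a α (shift t x)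
    shift-TypeII t {x} IIx with Equivalence.to TypeII⇔ IIx
    ... | (_ , Qx≡0) , x∉α , x⊥α = TypeII-norm Qx+tp≡0 x+tp∉α (Perp-+ x⊥α (InSpan⇒Perp tp∈α))
      where
      tp∈α : InSpan α (t · p)
      tp∈α = InSpan-· t p∈α
      x+tp∉α : ¬ InSpan α (x +V (t · p))
      x+tp∉α x+tp∈α = x∉α (subst (InSpan α) (x+u-u≡x x (t · p)) (InSpan-+ x+tp∈α (InSpan-· (- 1#) tp∈α)))
      Qx+tp≡0 : Q a (x +V (t · p)) ≡ 0#
      Qx+tp≡0 = begin
        Q a (x +V (t · p))                       ≡⟨ Q-+ x (t · p) ⟩
        (Q a x + Q a (t · p)) + polar x (t · p)  ≡⟨ cong₂ (λ u w → (u + w) + polar x (t · p)) Qx≡0 (ContainedIn⇒Q≡0 α⊆Q tp∈α) ⟩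
        (0# + 0#) + polar x (t · p)              ≡⟨ cong ((0# + 0#) +_) (trans (polar-sym x _) (Perp-InSpan x⊥α tp∈α)) ⟩
        (0# + 0#) + 0#                           ≡⟨ trans (+-identityʳ _) (+-identityˡ 0#) ⟩
        0#                                       ∎

    polar-shift : ∀ t x → ∃ λ l → l ≢ 0# × shift t x ≡ l · (x +V (t · p)) × polar y (shift t x) ≡ l * (polar y x + t)
    polar-shift t x with norm-scalar (x +V (t · p))
    ... | l , l≢0 , eq = l , l≢0 , eq , (begin
      polar y (shift t x)                ≡⟨ cong (polar y) eq ⟩
      polar y (l · (x +V (t · p)))       ≡⟨ polar-·ʳ y l _ ⟩
      l * polar y (x +V (t · p))         ≡⟨ cong (l *_) (polar-+ʳ y x _) ⟩
      l * (polar y x + polar y (t · p))  ≡⟨ cong (λ u → l * (polar y x + u)) (trans (polar-·ʳ y t p) (trans (cong (t *_) yp≡1) (*-identityʳ t))) ⟩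
      l * (polar y x + t)                ∎)

    shift-injective : ∀ {t t′ x x′} → TypeII a α x → TypeII a α x′ → polar y x ≡ 0# → polar y x′ ≡ 0# →
                      shift t x ≡ shift t′ x′ → t ≡ t′ × x ≡ x′
    shift-injective {t} {t′} {x} {x′} IIx IIx′ yx≡0 yx′≡0 eq with polar-shift t x | polar-shift t′ x′
    ... | l , l≢0 , eqₓ , yeqₓ | l′ , l′≢0 , eqₓ′ , yeqₓ′ = t≡t′ , x≡x′
      where
      lt≡l′t′ : l * t ≡ l′ * t′
      lt≡l′t′ = begin
        l * t                   ≡⟨ cong (l *_) (sym (trans (cong (_+ t) yx≡0) (+-identityˡ t))) ⟩
        l * (polar y x + t)     ≡⟨ sym yeqₓ ⟩
        polar y (shift t x)     ≡⟨ cong (polar y) eq ⟩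
        polar y (shift t′ x′)   ≡⟨ yeqₓ′ ⟩
        l′ * (polar y x′ + t′)  ≡⟨ cong (l′ *_) (trans (cong (_+ t′) yx′≡0) (+-identityˡ t′)) ⟩
        l′ * t′                 ∎
      lx≡l′x′ : l · x ≡ l′ · x′
      lx≡l′x′ = +V-cancelʳ ((l * t) · p) _ _ (begin
        (l · x) +V ((l * t) · p)      ≡⟨ sym (·-shift l x t) ⟩
        l · (x +V (t · p))            ≡⟨ trans (sym eqₓ) (trans eq eqₓ′) ⟩
        l′ · (x′ +V (t′ · p))         ≡⟨ ·-shift l′ x′ t′ ⟩
        (l′ · x′) +V ((l′ * t′) · p)  ≡⟨ cong (λ c → (l′ · x′) +V (c · p)) (sym lt≡l′t′) ⟩
        (l′ · x′) +V ((l * t) · p)    ∎)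
      x≡l⁻¹l′x′ : x ≡ (inv l l≢0 * l′) · x′
      x≡l⁻¹l′x′ = trans (sym (·-inv l l≢0 x)) (trans (cong (inv l l≢0 ·_) lx≡l′x′) (·-assoc _ _ x′))
      l⁻¹l′≡1 : inv l l≢0 * l′ ≡ 1#
      l⁻¹l′≡1 = Normalized-scalar≡1 _ (proj₁ (proj₁ IIx)) (proj₁ (proj₁ IIx′)) x≡l⁻¹l′x′
      x≡x′ : x ≡ x′
      x≡x′ = trans x≡l⁻¹l′x′ (trans (cong (_· x′) l⁻¹l′≡1) (·-identityˡ x′))
      l′≡l : l′ ≡ l
      l′≡l = *-cancelˡ (inv l l≢0) l′ l (inv≢0 l l≢0) (trans l⁻¹l′≡1 (sym (inv-inverseˡ l l≢0)))
      t≡t′ : t ≡ t′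
      t≡t′ = *-cancelˡ l t t′ l≢0 (trans lt≡l′t′ (cong (_* t′) l′≡l))

    shift-onto : ∀ {z} → TypeII a α z → ∃₂ λ t x → (TypeII a α x × polar y x ≡ 0#) × shift t x ≡ z
    shift-onto {z} IIz with polar-shift (- polar y z) z
    ... | l , l≢0 , eq , yeq = l * u , shift (- u) z , (shift-TypeII (- u) IIz , yx≡0) , back
      where
      u = polar y z
      nz = proj₁ (proj₁ IIz)
      yx≡0 : polar y (shift (- u) z) ≡ 0#
      yx≡0 = trans yeq (trans (cong (l *_) (-‿inverseʳ u)) (zeroʳ l))
      cancel : (l · (z +V ((- u) · p))) +V ((l * u) · p) ≡ l · z
      cancel = begin
        (l · (z +V ((- u) · p))) +V ((l * u) · p)     ≡⟨ cong (_+V ((l * u) · p)) (·-shift l z (- u)) ⟩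
        ((l · z) +V ((l * - u) · p)) +V ((l * u) · p) ≡⟨ +V-assoc _ _ _ ⟩
        (l · z) +V (((l * - u) · p) +V ((l * u) · p)) ≡⟨ cong ((l · z) +V_) (sym (·-distribʳ _ _ p)) ⟩
        (l · z) +V ((l * - u + l * u) · p)            ≡⟨ cong (λ c → (l · z) +V (c · p)) (trans (sym (distribˡ l (- u) u)) (trans (cong (l *_) (-‿inverseˡ u)) (zeroʳ l))) ⟩
        (l · z) +V (0# · p)                           ≡⟨ trans (cong ((l · z) +V_) (·-zeroˡ p)) (+V-identityʳ _) ⟩
        l · z                                         ∎
      back : shift (l * u) (shift (- u) z) ≡ z
      back = begin
        norm (shift (- u) z +V ((l * u) · p))           ≡⟨ cong (λ w → norm (w +V ((l * u) · p))) eq ⟩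
        norm ((l · (z +V ((- u) · p))) +V ((l * u) · p)) ≡⟨ cong norm cancel ⟩
        norm (l · z)                                      ≡⟨ norm-· l z l≢0 (Normalized⇒≢zeroV nz) ⟩
        norm z                                            ≡⟨ norm-Normalized nz ⟩
        z                                                 ∎

    HasSize-𝒳-from-neighbours : QPoint a y → ¬ TypeII a α y → ∀ {c} →
                HasSize (Neighbours y) c → HasSize (𝒳 a α) (size ℕ.* c)
    HasSize-𝒳-from-neighbours qy y∉𝒳 |N| =
      HasSize-image (λ (t , x) → shift t x) injective (λ {(t , _)} (_ , IIx , _) → shift-TypeII t IIx) onto
        (HasSize-× F-cardinality |N|)
      where
      y≢ : ∀ {x} → TypeII a α x → y ≢ x
      y≢ IIx refl = y∉𝒳 IIx
      yx≡0 : ∀ {x} → Adjacent a y x → polar y x ≡ 0#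
      yx≡0 adj = proj₂ (proj₂ (proj₂ (Equivalence.to Adjacent⇔ adj)))
      injective : ∀ {tx tx′} → ⊤ × Neighbours y (proj₂ tx) → ⊤ × Neighbours y (proj₂ tx′) →
                  shift (proj₁ tx) (proj₂ tx) ≡ shift (proj₁ tx′) (proj₂ tx′) → tx ≡ tx′
      injective (_ , IIx , adj) (_ , IIx′ , adj′) eq = ×-≡,≡→≡ (shift-injective IIx IIx′ (yx≡0 adj) (yx≡0 adj′) eq)
      onto : ∀ {z} → 𝒳 a α z → ∃ λ tx → (⊤ × Neighbours y (proj₂ tx)) × shift (proj₁ tx) (proj₂ tx) ≡ z
      onto IIz with shift-onto IIz
      ... | t , x , (IIx , yx≡0) , eq =
        (t , x) , (tt , IIx , Equivalence.from Adjacent⇔ (qy , proj₁ IIx , y≢ IIx , yx≡0)) , eq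

  TypeI-neighbours : ∀ {y c m} → TypeI a α y →
                     HasSize (Neighbours y) c → HasSize (𝒳 a α) m → c ≡ m
  TypeI-neighbours {y} (qy , y∈α) |N| |𝒳| =
    HasSize-unique (HasSize-image (λ x → x) (λ _ _ eq → eq) proj₁ (λ IIx → _ , (IIx , adjacent IIx) , refl) |N|) |𝒳|
    where
    adjacent : ∀ {x} → TypeII a α x → Adjacent a y x
    adjacent IIx with Equivalence.to TypeII⇔ IIx
    ... | qx , x∉α , x⊥α = Equivalence.from Adjacent⇔ (qy , qx , (λ { refl → x∉α y∈α }) , Perp-InSpan x⊥α y∈α)

  TypeIII⇒∃-polar≡1 : ∀ {y} → TypeIII a α y → ∃ λ p → InSpan α p × polar y p ≡ 1#
  TypeIII⇒∃-polar≡1 {y} (qy , ¬I , ¬II) with All⊎∃¬ (λ v → polar v y ≟ 0#) α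
  ... | inj₁ y⊥α          = ⊥-elim (¬II (Equivalence.from TypeII⇔ (qy , (λ y∈α → ¬I (qy , y∈α)) , y⊥α)))
  ... | inj₂ (j , vy≢0) = γ⁻¹ · v , InSpan-· γ⁻¹ (VecAllₚ.lookup⁺ (InSpan-self α) j) ,
    trans (polar-·ʳ y γ⁻¹ v) (trans (cong (γ⁻¹ *_) (polar-sym y v)) (inv-inverseˡ (polar v y) vy≢0))
    where
    v = Vec.lookup α j
    γ⁻¹ = inv (polar v y) vy≢0

  TypeIII-neighbours : ∀ {y c m} → TypeIII a α y →
                       HasSize (Neighbours y) c → HasSize (𝒳 a α) m → m ≡ size ℕ.* c
  TypeIII-neighbours yIII@(qy , _ , ¬II) |N| |𝒳| with TypeIII⇒∃-polar≡1 yIII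
  ... | p , p∈α , yp≡1 = HasSize-unique |𝒳| (Shift.HasSize-𝒳-from-neighbours _ p p∈α yp≡1 qy ¬II |N|)

  TypeIII-∃-neighbour : ∀ {y} → TypeIII a α y → ∃ (TypeII a α) → ∃ (Neighbours y)
  TypeIII-∃-neighbour yIII@(qy , _ , ¬II) (x₀ , IIx₀) with TypeIII⇒∃-polar≡1 yIII
  ... | p , p∈α , yp≡1 with Shift.shift-onto _ p p∈α yp≡1 IIx₀
  ...   | _ , x , (IIx , yx≡0) , _ =
    x , IIx , Equivalence.from Adjacent⇔ (qy , proj₁ IIx , (λ { refl → ¬II IIx }) , yx≡0)

  ∃-TypeII : ∀ {g} → ProjIndex a g → s < g → ∃ (TypeII a α)
  ∃-TypeII {g} ((W , indW , W⊆Q) , _) s<g =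
    lift (∃-orthogonal-outside-span α [] W indW W⊆Q (subst (_< suc g) (sym (ℕₚ.+-identityʳ (suc s))) (s≤s s<g)))
    where
    α⊆α++[] : VecAll.All (InSpan (α Vec.++ [])) α
    α⊆α++[] = proj₁ (VecAllₚ.++⁻ α (InSpan-self (α Vec.++ [])))
    lift : (∃ λ w → InSpan W w × Perp w × ¬ InSpan (α Vec.++ []) w) → ∃ (TypeII a α)
    lift (w , w∈W , w⊥α , w∉) =
      norm w , TypeII-norm (ContainedIn⇒Q≡0 W⊆Q w∈W) (λ w∈α → w∉ (InSpan-mono α⊆α++[] w∈α)) w⊥α

  ∃-TypeIII : NonSingular a → ∃ (TypeIII a α)
  ∃-TypeIII nonsing = lift (∃-singular-nonorthogonal nonsing a₀≢0 (ContainedIn⇒Q≡0 α⊆Q a₀∈α))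
    where
    a₀ = Vec.lookup α Fin.zero
    a₀∈α : InSpan α a₀
    a₀∈α = VecAllₚ.lookup⁺ (InSpan-self α) Fin.zero
    a₀≢0 : a₀ ≢ zeroV
    a₀≢0 = Independent⇒head≢0 α indα
    lift : (∃ λ y → Q a y ≡ 0# × polar a₀ y ≢ 0#) → ∃ (TypeIII a α)
    lift (y′ , Qy′≡0 , a₀y′≢0) with norm-scalar y′
    ... | l , l≢0 , eq = norm y′ , QPoint-norm y′≢0 Qy′≡0 ,
      (λ (_ , y∈α) → a₀y≢0 (ContainedIn⇒polar≡0 α⊆Q a₀∈α y∈α)) ,
      (λ IIy → a₀y≢0 (VecAllₚ.lookup⁺ (proj₂ (proj₂ (Equivalence.to TypeII⇔ IIy))) Fin.zero))
      where
      y′≢0 : y′ ≢ zeroV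
      y′≢0 y′≡0 = a₀y′≢0 (trans (cong (polar a₀) y′≡0) (polar-zeroʳ a₀))
      a₀y≢0 : polar a₀ (norm y′) ≢ 0#
      a₀y≢0 = subst (_≢ 0#) (sym (trans (cong (polar a₀) eq) (polar-·ʳ a₀ l y′))) (*-≢0 l _ l≢0 a₀y′≢0)

  CountAlternatives : V n → Set
  CountAlternatives y = ∀ c m → HasSize (Neighbours y) c → HasSize (𝒳 a α) m → c ≡ 0 ⊎ 2 ℕ.* c ≡ m ⊎ c ≡ m

  q≡2⇒CountAlternatives : size ≡ 2 → ∀ y → 𝒴 a α y → CountAlternatives y
  q≡2⇒CountAlternatives _   y (inj₁ yI)   c m |N| |𝒳| = inj₂ (inj₂ (TypeI-neighbours yI |N| |𝒳|))
  q≡2⇒CountAlternatives q≡2 y (inj₂ yIII) c m |N| |𝒳| =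
    inj₂ (inj₁ (sym (trans (TypeIII-neighbours yIII |N| |𝒳|) (cong (ℕ._* c) q≡2))))

  CountAlternatives⇒q≡2 : ∀ {g} → NonSingular a → ProjIndex a g → s < g →
                          (∀ y → 𝒴 a α y → CountAlternatives y) → size ≡ 2
  CountAlternatives⇒q≡2 nonsing index s<g alternatives = count-alternatives⇒q≡2 size c 2≤size c≢0
    (subst (λ m → c ≡ 0 ⊎ 2 ℕ.* c ≡ m ⊎ c ≡ m) (TypeIII-neighbours yIII |N| |𝒳|)
      (alternatives y (inj₂ yIII) c m |N| |𝒳|))
    where
    y : V n
    y = proj₁ (∃-TypeIII nonsing)
    yIII : TypeIII a α y
    yIII = proj₂ (∃-TypeIII nonsing)
    c m : ℕ
    c = proj₁ (HasSize-filter (Vec-cardinality (suc n)) (Neighbours? y))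
    m = proj₁ (HasSize-filter (Vec-cardinality (suc n)) TypeII?)
    |N| : HasSize (Neighbours y) c
    |N| = proj₂ (HasSize-filter (Vec-cardinality (suc n)) (Neighbours? y))
    |𝒳| : HasSize (𝒳 a α) m
    |𝒳| = proj₂ (HasSize-filter (Vec-cardinality (suc n)) TypeII?)
    c≢0 : c ≢ 0
    c≢0 = HasSize⇒≢0 |N| (proj₂ (TypeIII-∃-neighbour yIII (∃-TypeII index s<g)))

lemma4p3 : (K : FiniteField) (n : ℕ) (a : Geometry.QMat K n) →
    Geometry.NonSingular K a →
    (g : ℕ) → Geometry.ProjIndex K a g →
    (s : ℕ) → s < g →
    (α : Vec (Geometry.V K n) (suc s)) →
    Geometry.Independent K α → Geometry.ContainedIn K a α →
    ((∀ y → Geometry.𝒴 K a α y → ∀ c m →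
        HasSize (λ x → Geometry.𝒳 K a α x × Geometry.Adjacent K a y x) c →
        HasSize (Geometry.𝒳 K a α) m →
        (c ≡ 0 ⊎ 2 ℕ.* c ≡ m ⊎ c ≡ m))
     ⇔ (FiniteField.size K ≡ 2))
lemma4p3 K n a nonsing g index s s<g α indα α⊆Q =
  mk⇔ (CountAlternatives⇒q≡2 nonsing index s<g) q≡2⇒CountAlternatives
  where open PointTypes K a α indα α⊆Q
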